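{- Let $e\ge3$ and $M\ge2$ be integers, and let $\Lambda$ be a finite abelian subgroup of $(\mathbb{R}/\mathbb{Z})^e$ with $\mathrm{wt}(\Lambda)\le M$ and $|\mathrm{supp}(\Lambda)|=e$. Then: (a) $e\le f(M)\le 2M-1$. (b) If $e=2M-1$, then $M=2^r$ for some integer $r\ge1$. (c) If $e=f(M)$, then there exist $x_1,\dots,x_{\lfloor\log_2M\rfloor+1}\in\Lambda$ with $\bigcup_{i}\mathrm{supp}(x_i)=\mathrm{supp}(\Lambda)$; conversely (still assuming $e=f(M)$), if $x_1,\dots,x_q\in\Lambda$ satisfy $\bigcup_{i=1}^q\mathrm{supp}(x_i)=\mathrm{supp}(\Lambda)$, then $q\ge\lfloor\log_2M\rfloor+1$.
   Context: Each $x=(x_1,\dots,x_e)\in(\mathbb{R}/\mathbb{Z})^e$ is written with $0\le x_i<1$; $\mathrm{supp}(x)=\{i:x_i\ne0\}$, $\mathrm{wt}(x)=|\mathrm{supp}(x)|$. For a subgroup $\Lambda$, $\mathrm{supp}(\Lambda)=\bigcup_{x\in\Lambda}\mathrm{supp}(x)$ and $\mathrm{wt}(\Lambda)=\max_{x\in\Lambda}\mathrm{wt}(x)$. For a positive integer $M$, $f(M)=\sum_{n\ge0}\lfloor M/2^n\rfloor=\sum_{n=0}^{\lfloor\log_2M\rfloor}\lfloor M/2^n\rfloor$.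
   Formalization: The group Λ is taken as a finite subgroup of (ℚ/ℤ)^e rather than of (ℝ/ℤ)^e, its elements having rational coordinates in [0,1). -}

module Defs where

open import Data.Nat as ℕ using (ℕ; zero; suc; ⌊_/2⌋)
open import Data.Nat.Logarithm using (⌊log₂_⌋)
open import Data.Rational as ℚ using (ℚ; 0ℚ; 1ℚ; floor; _/_; _≟_)
open import Data.Vec as Vec using (Vec; zipWith; replicate; foldr)
open import Data.List as List using (List; upTo)
open import Data.Nat.ListAction using (sum)
open import Data.List.Membership.Propositional using (_∈_)
open import Data.List.Relation.Unary.All as LAll using ()
open import Data.Vec.Relation.Unary.All as VAll using ()
open import Data.Fin using (Fin)
open import Data.Fin.Subset using (Subset; inside; outside; _∪_; ⊥)
open import Data.Product using (_×_)
open import Relation.Nullary.Decidable using (does)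
open import Data.Bool using (if_then_else_)
open import Function using (_∘_)

-- Points of ℝ/ℤ of finite order are exactly the rational points, so a FINITE
-- subgroup of (ℝ/ℤ)^e lies in (ℚ/ℤ)^e.  We represent an element of (ℚ/ℤ)^e by its
-- canonical representative x = (x_1,…,x_e) with 0 ≤ x_i < 1.

red : ℚ → ℚ
red q = q ℚ.- (floor q / 1)

Pt : ℕ → Set
Pt e = Vec ℚ e

Reduced : ∀ {e} → Pt e → Set
Reduced x = VAll.All (λ a → (0ℚ ℚ.≤ a) × (a ℚ.< 1ℚ)) x

_⊕_ : ∀ {e} → Pt e → Pt e → Pt e
x ⊕ y = zipWith (λ a b → red (a ℚ.+ b)) x y

⊖_ : ∀ {e} → Pt e → Pt e
⊖ x = Vec.map (λ a → red (ℚ.- a)) x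

𝟘 : ∀ {e} → Pt e
𝟘 = replicate _ 0ℚ

record IsFiniteSubgroup {e : ℕ} (Λ : List (Pt e)) : Set where
  field
    reduced : LAll.All Reduced Λ
    has-zero : 𝟘 ∈ Λ
    closed-+ : ∀ {x y} → x ∈ Λ → y ∈ Λ → (x ⊕ y) ∈ Λ
    closed-neg : ∀ {x} → x ∈ Λ → (⊖ x) ∈ Λ

supp : ∀ {e} → Pt e → Subset e
supp x = Vec.map (λ a → if does (a ≟ 0ℚ) then outside else inside) x

wt : ∀ {e} → Pt e → ℕ
wt x = Data.Fin.Subset.∣ supp x ∣

⋃suppL : ∀ {e} → List (Pt e) → Subset e
⋃suppL xs = List.foldr (λ x s → supp x ∪ s) ⊥ xs

⋃suppV : ∀ {e q} → Vec (Pt e) q → Subset e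
⋃suppV xs = foldr _ (λ x s → supp x ∪ s) ⊥ xs

suppΛ : ∀ {e} → List (Pt e) → Subset e
suppΛ = ⋃suppL

WtLe : ∀ {e} → List (Pt e) → ℕ → Set
WtLe Λ M = ∀ {x} → x ∈ Λ → wt x ℕ.≤ M

halfIter : ℕ → ℕ → ℕ
halfIter zero M = M
halfIter (suc n) M = ⌊ halfIter n M /2⌋

f : ℕ → ℕ
f M = sum (List.map (λ n → halfIter n M) (upTo (suc ⌊log₂ M ⌋)))

module Submission where

-- Write wtOn C z = ∣ C ∩ supp z ∣ for a set C of coordinates.  If u has maximal wtOn C in a
-- subgroup and z is another element, the coordinates of supp u ─ supp z and of supp z ─ supp u
-- all survive in u ⊕ z, so wtOn C (u ⊕ z) ≤ wtOn C u bounds the part of z in C outside supp u by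
-- the overlap of z with u, and then wtOn C z ≤ wtOn C u bounds it by half of wtOn C u.
-- Peeling off maximal elements and passing to C ─ supp u, the k-th element therefore meets at
-- most ⌊M/2^k⌋ new coordinates, so q elements of a subgroup of weight ≤ M cover at most
-- M + ⌊M/2⌋ + ⋯ (q terms) coordinates; this is f(M) for q = ⌊log₂ M⌋ + 1 and less for fewer.
-- Done greedily inside Λ, all weights vanish after ⌊log₂ M⌋ + 1 steps, so that many elements
-- cover supp Λ, whence e ≤ f(M).  For q given elements one works inside their span, writing
-- its maximal element x as d·u where u together with q − 1 further elements of the span still
-- covers the supports of the given ones (Euclid's algorithm on the coefficients), so that the
-- number of generators drops by one at each step.  Finally 2M − 1 − f(M) is the binary digit
-- sum of M minus one, whence f(M) ≤ 2M − 1 with equality only for powers of two.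

open import Defs
open import Data.Nat using (ℕ; suc; _+_; _*_; _∸_; _^_; _≤_; _≥_)
open import Data.Nat.Logarithm using (⌊log₂_⌋)
open import Data.Rational using (ℚ)
open import Data.List using (List)
open import Data.List.Membership.Propositional using (_∈_)
open import Data.Vec using (Vec)
open import Data.Vec.Relation.Unary.All using (All)
open import Data.Fin.Subset using (∣_∣)
open import Data.Product using (_×_; Σ; ∃)
open import Relation.Binary.PropositionalEquality using (_≡_)

open import Data.Bool using (if_then_else_)
open import Data.Fin using (Fin; zero; suc)
open import Data.Fin.Subset using (Subset; inside; outside; _∪_; _∩_; _─_; ⊥; ⊤; Empty)
  renaming (_∈_ to _∈ˢ_; _∉_ to _∉ˢ_; _⊆_ to _⊆ˢ_)
open import Data.Fin.Subset.Properties
  using (_∈?_; x∈p∪q⁺; x∈p∪q⁻; x∈p∩q⁺; x∈p∩q⁻; x∈p∧x∉q⇒x∈p─q; p─q⊆p; p∩q⊆q; p⊆q⇒∣p∣≤∣q∣;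
         Empty-unique; ∣⊥∣≡0; ∩-comm; ∩-zeroʳ; ∩-identityˡ; ∉⊥; ∈⊤; ⊆-antisym; x∈p⇒∣p-x∣<∣p∣)
open import Data.Integer as ℤ using (ℤ; 0ℤ; 1ℤ; +0; +[1+_]; -[1+_])
import Data.Integer.Properties as ℤ
import Data.Integer.DivMod as ℤ
open import Data.List using (upTo; []; _∷_)
import Data.List as List
open import Data.List.Properties using (upTo-∷ʳ; map-++)
open import Data.List.Relation.Unary.Any using (here; there)
import Data.List.Relation.Unary.All as LAll
open import Data.List.Extrema.Nat using (argmax; argmax-all; f[xs]≤f[argmax])
open import Data.Nat using (zero; z≤n; s≤s; _<_; ⌊_/2⌋; ⌈_/2⌉)
open import Data.Nat.Coprimality using (1-coprimeTo)
import Data.Nat.Coprimality as Coprime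
open import Data.Nat.Induction using (<-wellFounded; <-rec)
open import Data.Nat.ListAction using (sum)
open import Data.Nat.ListAction.Properties using (sum-++)
open import Data.Nat.Logarithm.Core using (⌊log2⌋-acc-irrelevant)
open import Data.Nat.Properties
  using (≤-refl; ≤-reflexive; ≤-trans; ≤-antisym; ≤-total; _≤?_; <⇒≱; ≮⇒≥; n≮0; m<1+n⇒m≤n;
         +-comm; +-assoc; +-suc; +-identityʳ; *-identityˡ; *-identityʳ; *-assoc; +-cancelˡ-≡; +-cancelˡ-≤;
         m≤m+n; m<m+n; m<n+m; +-mono-≤; +-monoˡ-≤; +-monoʳ-≤; +-monoʳ-<; m∸n+n≡m; m+n≤o⇒m≤o∸n;
         m≤n⇒∃[o]m+o≡n; ⌊n/2⌋-mono; ⌊n/2⌋<n; ⌊n/2⌋≤⌈n/2⌉; ⌊n/2⌋+⌈n/2⌉≡n; n≡⌊n+n/2⌋; module ≤-Reasoning)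
open import Data.Product using (_,_; proj₁; proj₂)
import Data.Rational as ℚ
open import Data.Rational using (0ℚ; 1ℚ)
import Data.Rational.Properties as ℚ
open import Data.Rational.Solver using (module +-*-Solver)
open import Data.Sum using (inj₁; inj₂; [_,_]′)
open import Data.Vec using ([]; _∷_; _++_; lookup; replicate; zipWith; here; there)
open import Data.Vec.Properties using ([]=⇒lookup; lookup⇒[]=; lookup-map; lookup-zipWith; lookup-replicate)
open import Data.Vec.Relation.Unary.All using ([]; _∷_)
import Data.Vec.Relation.Unary.All as All
import Data.Vec.Relation.Unary.All.Properties as All
open import Data.Vec.Relation.Unary.Any using (Any; here; there)
import Data.Vec.Relation.Unary.Any.Properties as Any
open import Function using (id; _∘_)
open import Induction.WellFounded using (Acc; acc)
open import Relation.Binary.PropositionalEquality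
  using (_≢_; refl; sym; trans; cong; cong₂; subst; subst₂; module ≡-Reasoning)
open import Relation.Nullary using (Dec; yes; no; does; ¬_; contradiction; ¬¬-map)
open import Relation.Nullary.Decidable using (decidable-stable)

-- Reduction modulo 1

ι : ℤ → ℚ
ι i = i ℚ./ 1

integral : ℤ → ℚ
integral i = ℚ.mkℚ i 0 (Coprime.sym (1-coprimeTo ℤ.∣ i ∣))

ι≡integral : ∀ i → ι i ≡ integral i
ι≡integral i = ℚ.↥p/↧p≡p (integral i)

ι-+ : ∀ i j → ι (i ℤ.+ j) ≡ ι i ℚ.+ ι j
ι-+ i j rewrite ι≡integral i | ι≡integral j =
  cong (ℚ._/ 1) (sym (cong₂ ℤ._+_ (ℤ.*-identityʳ i) (ℤ.*-identityʳ j)))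

ι-neg : ∀ i → ι (ℤ.- i) ≡ ℚ.- ι i
ι-neg i rewrite ι≡integral i | ι≡integral (ℤ.- i) = neg-integral i
  where
  neg-integral : ∀ i → integral (ℤ.- i) ≡ ℚ.- integral i
  neg-integral +0       = refl
  neg-integral +[1+ n ] = refl
  neg-integral -[1+ n ] = refl

ι-cancel-< : ∀ {i j} → ι i ℚ.< ι j → i ℤ.< j
ι-cancel-< {i} {j} lt rewrite ι≡integral i | ι≡integral j with ℚ.drop-*<* lt
... | i*1<j*1 rewrite ℤ.*-identityʳ i | ℤ.*-identityʳ j = i*1<j*1

ι[floor]≤ : ∀ p → ι (ℚ.floor p) ℚ.≤ p
ι[floor]≤ p@(ℚ.mkℚ n d _) rewrite ι≡integral (ℚ.floor p) = ℚ.*≤* n/d*d≤n*1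
  where
  n/d*d≤n*1 : (n ℤ./ +[1+ d ]) ℤ.* +[1+ d ] ℤ.≤ n ℤ.* 1ℤ
  n/d*d≤n*1 rewrite ℤ.*-identityʳ n = ℤ.[n/d]*d≤n n (+[1+ d ])

<ι[floor+1] : ∀ p → p ℚ.< ι (ℚ.floor p ℤ.+ 1ℤ)
<ι[floor+1] p@(ℚ.mkℚ n d _) rewrite ι≡integral (ℚ.floor p ℤ.+ 1ℤ) = ℚ.*<* n*1<[n/d+1]*d
  where
  n/d+1≡ : n ℤ./ +[1+ d ] ℤ.+ 1ℤ ≡ ℤ.suc (n ℤ./ℕ suc d)
  n/d+1≡ = trans (cong (ℤ._+ 1ℤ) (ℤ.div-pos-is-/ℕ n (suc d))) (ℤ.+-comm (n ℤ./ℕ suc d) 1ℤ)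
  n*1<[n/d+1]*d : n ℤ.* 1ℤ ℤ.< (n ℤ./ +[1+ d ] ℤ.+ 1ℤ) ℤ.* +[1+ d ]
  n*1<[n/d+1]*d = subst₂ ℤ._<_ (sym (ℤ.*-identityʳ n)) (cong (ℤ._* +[1+ d ]) (sym n/d+1≡))
                    (ℤ.n<s[n/ℕd]*d n (suc d))

floor-unique : ∀ p n → ι n ℚ.≤ p → p ℚ.< ι (n ℤ.+ 1ℤ) → ℚ.floor p ≡ n
floor-unique p n n≤p p<n+1 = ℤ.≤-antisym
  (<+1⇒≤ (ι-cancel-< (ℚ.≤-<-trans (ι[floor]≤ p) p<n+1)))
  (<+1⇒≤ (ι-cancel-< (ℚ.≤-<-trans n≤p (<ι[floor+1] p))))
  where
  <+1⇒≤ : ∀ {i j} → i ℤ.< j ℤ.+ 1ℤ → i ℤ.≤ j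
  <+1⇒≤ {i} {j} i<j+1 = subst (i ℤ.≤_) (trans (cong ℤ.pred (ℤ.+-comm j 1ℤ)) (ℤ.pred-suc j))
                          (ℤ.i<j⇒i≤pred[j] i<j+1)

open +-*-Solver

floor-+ι : ∀ p k → ℚ.floor (p ℚ.+ ι k) ≡ ℚ.floor p ℤ.+ k
floor-+ι p k = floor-unique (p ℚ.+ ι k) (ℚ.floor p ℤ.+ k)
  (subst (ℚ._≤ p ℚ.+ ι k) (sym (ι-+ (ℚ.floor p) k)) (ℚ.+-monoˡ-≤ (ι k) (ι[floor]≤ p)))
  (subst (p ℚ.+ ι k ℚ.<_) shift (ℚ.+-monoˡ-< (ι k) (<ι[floor+1] p)))
  where
  +-right-comm : ∀ i j k → i ℤ.+ j ℤ.+ k ≡ i ℤ.+ k ℤ.+ j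
  +-right-comm i j k =
    trans (ℤ.+-assoc i j k) (trans (cong (λ l → i ℤ.+ l) (ℤ.+-comm j k)) (sym (ℤ.+-assoc i k j)))
  shift : ι (ℚ.floor p ℤ.+ 1ℤ) ℚ.+ ι k ≡ ι (ℚ.floor p ℤ.+ k ℤ.+ 1ℤ)
  shift = trans (sym (ι-+ (ℚ.floor p ℤ.+ 1ℤ) k)) (cong ι (+-right-comm (ℚ.floor p) 1ℤ k))

red-+ι : ∀ p k → red (p ℚ.+ ι k) ≡ red p
red-+ι p k = begin
  (p ℚ.+ ι k) ℚ.- ι (ℚ.floor (p ℚ.+ ι k))  ≡⟨ cong (λ i → (p ℚ.+ ι k) ℚ.- ι i) (floor-+ι p k) ⟩
  (p ℚ.+ ι k) ℚ.- ι (ℚ.floor p ℤ.+ k)       ≡⟨ cong (λ q → (p ℚ.+ ι k) ℚ.- q) (ι-+ (ℚ.floor p) k) ⟩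
  (p ℚ.+ ι k) ℚ.- (ι (ℚ.floor p) ℚ.+ ι k)   ≡⟨ solve 3 (λ a b c → (a :+ b) :- (c :+ b) := a :- c) refl
                                                  p (ι k) (ι (ℚ.floor p)) ⟩
  p ℚ.- ι (ℚ.floor p)                       ∎
  where open ≡-Reasoning

red-assoc : ∀ a b c → red (red (a ℚ.+ b) ℚ.+ c) ≡ red (a ℚ.+ red (b ℚ.+ c))
red-assoc a b c = begin
  red (red (a ℚ.+ b) ℚ.+ c)      ≡⟨ cong red (solve 4 (λ a b c k → (a :+ b :- k) :+ c := a :+ b :+ c :- k)
                                                 refl a b c (ι k₁)) ⟩
  red (a ℚ.+ b ℚ.+ c ℚ.- ι k₁)   ≡⟨ unshift k₁ ⟩
  red (a ℚ.+ b ℚ.+ c)            ≡⟨ sym (unshift k₂) ⟩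
  red (a ℚ.+ b ℚ.+ c ℚ.- ι k₂)   ≡⟨ cong red (solve 4 (λ a b c k → a :+ b :+ c :- k := a :+ (b :+ c :- k))
                                                 refl a b c (ι k₂)) ⟩
  red (a ℚ.+ red (b ℚ.+ c))      ∎
  where
  open ≡-Reasoning
  k₁ : ℤ
  k₁ = ℚ.floor (a ℚ.+ b)
  k₂ : ℤ
  k₂ = ℚ.floor (b ℚ.+ c)
  unshift : ∀ k → red (a ℚ.+ b ℚ.+ c ℚ.- ι k) ≡ red (a ℚ.+ b ℚ.+ c)
  unshift k = trans (cong (λ q → red (a ℚ.+ b ℚ.+ c ℚ.+ q)) (sym (ι-neg k))) (red-+ι (a ℚ.+ b ℚ.+ c) (ℤ.- k))

red-fixed : ∀ a → 0ℚ ℚ.≤ a → a ℚ.< 1ℚ → red a ≡ a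
red-fixed a 0≤a a<1 = trans (cong (λ i → a ℚ.- ι i) (floor-unique a 0ℤ 0≤a a<1)) (ℚ.+-identityʳ a)

red-nonneg : ∀ a → 0ℚ ℚ.≤ red a
red-nonneg a = subst (ℚ._≤ red a) (ℚ.+-inverseʳ (ι (ℚ.floor a)))
                 (ℚ.+-monoˡ-≤ (ℚ.- ι (ℚ.floor a)) (ι[floor]≤ a))

red-<1 : ∀ a → red a ℚ.< 1ℚ
red-<1 a = subst (red a ℚ.<_) cancel (ℚ.+-monoˡ-< (ℚ.- ι (ℚ.floor a)) (<ι[floor+1] a))
  where
  cancel : ι (ℚ.floor a ℤ.+ 1ℤ) ℚ.- ι (ℚ.floor a) ≡ 1ℚ
  cancel = begin
    ι (ℚ.floor a ℤ.+ 1ℤ) ℚ.- ι (ℚ.floor a)        ≡⟨ cong (λ q → ι q ℚ.- ι (ℚ.floor a)) (ℤ.+-comm (ℚ.floor a) 1ℤ) ⟩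
    ι (1ℤ ℤ.+ ℚ.floor a) ℚ.- ι (ℚ.floor a)        ≡⟨ cong (ℚ._- ι (ℚ.floor a)) (ι-+ 1ℤ (ℚ.floor a)) ⟩
    (1ℚ ℚ.+ ι (ℚ.floor a)) ℚ.- ι (ℚ.floor a)      ≡⟨ solve 2 (λ o f → (o :+ f) :- f := o) refl 1ℚ (ι (ℚ.floor a)) ⟩
    1ℚ                                            ∎
    where open ≡-Reasoning

-- Counting in finite sets

∣p∪q∣+∣p∩q∣≡∣p∣+∣q∣ : ∀ {n} (p q : Subset n) → ∣ p ∪ q ∣ + ∣ p ∩ q ∣ ≡ ∣ p ∣ + ∣ q ∣
∣p∪q∣+∣p∩q∣≡∣p∣+∣q∣ [] [] = refl
∣p∪q∣+∣p∩q∣≡∣p∣+∣q∣ (inside  ∷ p) (inside  ∷ q) =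
  cong suc (trans (+-suc _ _) (trans (cong suc (∣p∪q∣+∣p∩q∣≡∣p∣+∣q∣ p q)) (sym (+-suc _ _))))
∣p∪q∣+∣p∩q∣≡∣p∣+∣q∣ (inside  ∷ p) (outside ∷ q) = cong suc (∣p∪q∣+∣p∩q∣≡∣p∣+∣q∣ p q)
∣p∪q∣+∣p∩q∣≡∣p∣+∣q∣ (outside ∷ p) (inside  ∷ q) =
  trans (cong suc (∣p∪q∣+∣p∩q∣≡∣p∣+∣q∣ p q)) (sym (+-suc _ _))
∣p∪q∣+∣p∩q∣≡∣p∣+∣q∣ (outside ∷ p) (outside ∷ q) = ∣p∪q∣+∣p∩q∣≡∣p∣+∣q∣ p q

∣p∣≡∣p∩q∣+∣p─q∣ : ∀ {n} (p q : Subset n) → ∣ p ∣ ≡ ∣ p ∩ q ∣ + ∣ p ─ q ∣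
∣p∣≡∣p∩q∣+∣p─q∣ [] [] = refl
∣p∣≡∣p∩q∣+∣p─q∣ (inside  ∷ p) (inside  ∷ q) = cong suc (∣p∣≡∣p∩q∣+∣p─q∣ p q)
∣p∣≡∣p∩q∣+∣p─q∣ (inside  ∷ p) (outside ∷ q) = trans (cong suc (∣p∣≡∣p∩q∣+∣p─q∣ p q)) (sym (+-suc _ _))
∣p∣≡∣p∩q∣+∣p─q∣ (outside ∷ p) (inside  ∷ q) = ∣p∣≡∣p∩q∣+∣p─q∣ p q
∣p∣≡∣p∩q∣+∣p─q∣ (outside ∷ p) (outside ∷ q) = ∣p∣≡∣p∩q∣+∣p─q∣ p q

∣p∪q∣≤∣p∣+∣q∣ : ∀ {n} (p q : Subset n) → ∣ p ∪ q ∣ ≤ ∣ p ∣ + ∣ q ∣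
∣p∪q∣≤∣p∣+∣q∣ p q = subst (∣ p ∪ q ∣ ≤_) (∣p∪q∣+∣p∩q∣≡∣p∣+∣q∣ p q) (m≤m+n _ _)

∣p∣+∣q∣≤∣p∪q∣ : ∀ {n} (p q : Subset n) → Empty (p ∩ q) → ∣ p ∣ + ∣ q ∣ ≤ ∣ p ∪ q ∣
∣p∣+∣q∣≤∣p∪q∣ {n} p q p∩q=∅ = begin
  ∣ p ∣ + ∣ q ∣              ≡⟨ sym (∣p∪q∣+∣p∩q∣≡∣p∣+∣q∣ p q) ⟩
  ∣ p ∪ q ∣ + ∣ p ∩ q ∣      ≡⟨ cong (λ r → ∣ p ∪ q ∣ + ∣ r ∣) (Empty-unique p∩q=∅) ⟩
  ∣ p ∪ q ∣ + ∣ ⊥ {n} ∣      ≡⟨ cong (λ k → ∣ p ∪ q ∣ + k) (∣⊥∣≡0 n) ⟩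
  ∣ p ∪ q ∣ + 0              ≡⟨ +-identityʳ _ ⟩
  ∣ p ∪ q ∣                  ∎
  where open ≤-Reasoning

x∈p─q⇒x∉q : ∀ {n} {p q : Subset n} {x} → x ∈ˢ p ─ q → x ∉ˢ q
x∈p─q⇒x∉q {p = inside ∷ p} {outside ∷ q} here ()
x∈p─q⇒x∉q {p = _ ∷ p} {_ ∷ q} (there x∈) (there x∈q) = x∈p─q⇒x∉q x∈ x∈q

∪-lub : ∀ {n} {p q r : Subset n} → p ⊆ˢ r → q ⊆ˢ r → p ∪ q ⊆ˢ r
∪-lub {p = p} {q} p⊆r q⊆r x∈ = [ p⊆r , q⊆r ]′ (x∈p∪q⁻ p q x∈)

∩-monoʳ-⊆ : ∀ {n} (p : Subset n) {q r} → q ⊆ˢ r → p ∩ q ⊆ˢ p ∩ r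
∩-monoʳ-⊆ p {q} q⊆r x∈ = let x∈p , x∈q = x∈p∩q⁻ p q x∈ in x∈p∩q⁺ (x∈p , q⊆r x∈q)

∩-∪-split : ∀ {n} (p q r : Subset n) → p ∩ (q ∪ r) ⊆ˢ (p ∩ q) ∪ ((p ─ q) ∩ r)
∩-∪-split p q r {x} x∈ with x∈p∩q⁻ p (q ∪ r) x∈ | x ∈? q
... | x∈p , _     | yes x∈q = x∈p∪q⁺ (inj₁ (x∈p∩q⁺ (x∈p , x∈q)))
... | x∈p , x∈q∪r | no  x∉q = x∈p∪q⁺ (inj₂ (x∈p∩q⁺ (x∈p∧x∉q⇒x∈p─q x∈p x∉q , x∈r)))
  where
  x∈r : x ∈ˢ r
  x∈r = [ (λ x∈q → contradiction x∈q x∉q) , id ]′ (x∈p∪q⁻ q r x∈q∪r)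

─∩⊆⇒∩⊆∪ : ∀ {n} (p q r : Subset n) {s} → (p ─ q) ∩ r ⊆ˢ s → p ∩ r ⊆ˢ q ∪ s
─∩⊆⇒∩⊆∪ p q r ⊆s {x} x∈ with x ∈? q
... | yes x∈q = x∈p∪q⁺ (inj₁ x∈q)
... | no  x∉q = let x∈p , x∈r = x∈p∩q⁻ p r x∈ in
                x∈p∪q⁺ (inj₂ (⊆s (x∈p∩q⁺ (x∈p∧x∉q⇒x∈p─q x∈p x∉q , x∈r))))

∣t─s∣≤⌊∣s∣/2⌋ : ∀ {n} (s t w : Subset n) → s ─ t ⊆ˢ w → t ─ s ⊆ˢ w → ∣ w ∣ ≤ ∣ s ∣ → ∣ t ∣ ≤ ∣ s ∣ →
                ∣ t ─ s ∣ ≤ ⌊ ∣ s ∣ /2⌋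
∣t─s∣≤⌊∣s∣/2⌋ s t w s─t⊆w t─s⊆w ∣w∣≤∣s∣ ∣t∣≤∣s∣ =
  subst (_≤ ⌊ ∣ s ∣ /2⌋) (sym (n≡⌊n+n/2⌋ ∣ t ─ s ∣)) (⌊n/2⌋-mono twice≤∣s∣)
  where
  open ≤-Reasoning
  disjoint : Empty ((s ─ t) ∩ (t ─ s))
  disjoint (x , x∈) = let x∈s─t , x∈t─s = x∈p∩q⁻ (s ─ t) (t ─ s) x∈ in
                      x∈p─q⇒x∉q x∈s─t (p─q⊆p t s x∈t─s)
  ∣t─s∣≤∣s∩t∣ : ∣ t ─ s ∣ ≤ ∣ s ∩ t ∣
  ∣t─s∣≤∣s∩t∣ = +-cancelˡ-≤ ∣ s ─ t ∣ _ _ (begin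
    ∣ s ─ t ∣ + ∣ t ─ s ∣          ≤⟨ ∣p∣+∣q∣≤∣p∪q∣ (s ─ t) (t ─ s) disjoint ⟩
    ∣ (s ─ t) ∪ (t ─ s) ∣          ≤⟨ p⊆q⇒∣p∣≤∣q∣ (∪-lub s─t⊆w t─s⊆w) ⟩
    ∣ w ∣                          ≤⟨ ∣w∣≤∣s∣ ⟩
    ∣ s ∣                          ≡⟨ ∣p∣≡∣p∩q∣+∣p─q∣ s t ⟩
    ∣ s ∩ t ∣ + ∣ s ─ t ∣          ≡⟨ +-comm ∣ s ∩ t ∣ ∣ s ─ t ∣ ⟩
    ∣ s ─ t ∣ + ∣ s ∩ t ∣          ∎)
  twice≤∣s∣ : ∣ t ─ s ∣ + ∣ t ─ s ∣ ≤ ∣ s ∣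
  twice≤∣s∣ = begin
    ∣ t ─ s ∣ + ∣ t ─ s ∣          ≤⟨ +-monoˡ-≤ _ ∣t─s∣≤∣s∩t∣ ⟩
    ∣ s ∩ t ∣ + ∣ t ─ s ∣          ≡⟨ cong (λ r → ∣ r ∣ + ∣ t ─ s ∣) (∩-comm s t) ⟩
    ∣ t ∩ s ∣ + ∣ t ─ s ∣          ≡⟨ sym (∣p∣≡∣p∩q∣+∣p─q∣ t s) ⟩
    ∣ t ∣                          ≤⟨ ∣t∣≤∣s∣ ⟩
    ∣ s ∣                          ∎

-- The group (ℚ/ℤ)^e

⊕-comm : ∀ {e} (x y : Pt e) → x ⊕ y ≡ y ⊕ x
⊕-comm []      []      = refl
⊕-comm (a ∷ x) (b ∷ y) = cong₂ _∷_ (cong red (ℚ.+-comm a b)) (⊕-comm x y)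

⊕-assoc : ∀ {e} (x y z : Pt e) → (x ⊕ y) ⊕ z ≡ x ⊕ (y ⊕ z)
⊕-assoc []      []      []      = refl
⊕-assoc (a ∷ x) (b ∷ y) (c ∷ z) = cong₂ _∷_ (red-assoc a b c) (⊕-assoc x y z)

⊕-reduced : ∀ {e} (x y : Pt e) → Reduced (x ⊕ y)
⊕-reduced []      []      = []
⊕-reduced (a ∷ x) (b ∷ y) = (red-nonneg (a ℚ.+ b) , red-<1 (a ℚ.+ b)) ∷ ⊕-reduced x y

𝟘-reduced : ∀ {e} → Reduced (𝟘 {e})
𝟘-reduced {zero}  = []
𝟘-reduced {suc e} = (ℚ.≤-refl , ℚ.*<* (ℤ.+<+ (s≤s z≤n))) ∷ 𝟘-reduced

⊕-identityˡ : ∀ {e} {x : Pt e} → Reduced x → 𝟘 ⊕ x ≡ x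
⊕-identityˡ {x = []}    []                 = refl
⊕-identityˡ {x = a ∷ x} ((0≤a , a<1) ∷ rx) =
  cong₂ _∷_ (trans (cong red (ℚ.+-identityˡ a)) (red-fixed a 0≤a a<1)) (⊕-identityˡ rx)

⊕-identityʳ : ∀ {e} {x : Pt e} → Reduced x → x ⊕ 𝟘 ≡ x
⊕-identityʳ {x = x} rx = trans (⊕-comm x 𝟘) (⊕-identityˡ rx)

⊕-interchange : ∀ {e} (a b c d : Pt e) → (a ⊕ b) ⊕ (c ⊕ d) ≡ (a ⊕ c) ⊕ (b ⊕ d)
⊕-interchange a b c d = begin
  (a ⊕ b) ⊕ (c ⊕ d)  ≡⟨ ⊕-assoc a b (c ⊕ d) ⟩
  a ⊕ (b ⊕ (c ⊕ d))  ≡⟨ cong (a ⊕_) (sym (⊕-assoc b c d)) ⟩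
  a ⊕ ((b ⊕ c) ⊕ d)  ≡⟨ cong (λ t → a ⊕ (t ⊕ d)) (⊕-comm b c) ⟩
  a ⊕ ((c ⊕ b) ⊕ d)  ≡⟨ cong (a ⊕_) (⊕-assoc c b d) ⟩
  a ⊕ (c ⊕ (b ⊕ d))  ≡⟨ sym (⊕-assoc a c (b ⊕ d)) ⟩
  (a ⊕ c) ⊕ (b ⊕ d)  ∎
  where open ≡-Reasoning

-- Supports

inside⇒≢0 : ∀ {a : ℚ} (a≟0 : Dec (a ≡ 0ℚ)) → (if does a≟0 then outside else inside) ≡ inside → a ≢ 0ℚ
inside⇒≢0 (no a≢0) _ = a≢0

≢0⇒inside : ∀ {a : ℚ} (a≟0 : Dec (a ≡ 0ℚ)) → a ≢ 0ℚ → (if does a≟0 then outside else inside) ≡ inside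
≢0⇒inside (yes a≡0) a≢0 = contradiction a≡0 a≢0
≢0⇒inside (no _)    _   = refl

module _ {e : ℕ} {x : Pt e} {i : Fin e} where

  ∈supp⁻ : i ∈ˢ supp x → lookup x i ≢ 0ℚ
  ∈supp⁻ i∈ = inside⇒≢0 (lookup x i ℚ.≟ 0ℚ) (trans (sym (lookup-map i _ x)) ([]=⇒lookup i∈))

  ∈supp⁺ : lookup x i ≢ 0ℚ → i ∈ˢ supp x
  ∈supp⁺ xᵢ≢0 = lookup⇒[]= i (supp x) (trans (lookup-map i _ x) (≢0⇒inside (lookup x i ℚ.≟ 0ℚ) xᵢ≢0))

  ∉supp⇒≡0 : i ∉ˢ supp x → lookup x i ≡ 0ℚ
  ∉supp⇒≡0 i∉ = decidable-stable (lookup x i ℚ.≟ 0ℚ) (i∉ ∘ ∈supp⁺)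

lookup-⊕ : ∀ {e} (x y : Pt e) i → lookup (x ⊕ y) i ≡ red (lookup x i ℚ.+ lookup y i)
lookup-⊕ x y i = lookup-zipWith _ i x y

lookup-reduced : ∀ {e} {x : Pt e} → Reduced x → ∀ i → red (lookup x i) ≡ lookup x i
lookup-reduced ((0≤a , a<1) ∷ _)  zero    = red-fixed _ 0≤a a<1
lookup-reduced (_           ∷ rx) (suc i) = lookup-reduced rx i

∉supp-𝟘 : ∀ {e} i → i ∉ˢ supp (𝟘 {e})
∉supp-𝟘 i i∈ = ∈supp⁻ i∈ (lookup-replicate i 0ℚ)

∈supp-⊕ˡ : ∀ {e} {x y : Pt e} {i} → Reduced x → i ∈ˢ supp x → i ∉ˢ supp y → i ∈ˢ supp (x ⊕ y)
∈supp-⊕ˡ {x = x} {y} {i} rx i∈x i∉y = ∈supp⁺ λ sum≡0 → ∈supp⁻ i∈x (begin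
  lookup x i                          ≡⟨ sym (lookup-reduced rx i) ⟩
  red (lookup x i)                    ≡⟨ cong red (sym (ℚ.+-identityʳ (lookup x i))) ⟩
  red (lookup x i ℚ.+ 0ℚ)             ≡⟨ cong (λ b → red (lookup x i ℚ.+ b)) (sym (∉supp⇒≡0 i∉y)) ⟩
  red (lookup x i ℚ.+ lookup y i)     ≡⟨ sym (lookup-⊕ x y i) ⟩
  lookup (x ⊕ y) i                    ≡⟨ sum≡0 ⟩
  0ℚ                                  ∎)
  where open ≡-Reasoning

supp-⊕⊆∪ : ∀ {e} (x y : Pt e) → supp (x ⊕ y) ⊆ˢ supp x ∪ supp y
supp-⊕⊆∪ x y {i} i∈ with i ∈? supp x | i ∈? supp y
... | yes i∈x | _       = x∈p∪q⁺ (inj₁ i∈x)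
... | no  _   | yes i∈y = x∈p∪q⁺ (inj₂ i∈y)
... | no  i∉x | no  i∉y = contradiction (begin
  lookup (x ⊕ y) i                 ≡⟨ lookup-⊕ x y i ⟩
  red (lookup x i ℚ.+ lookup y i)  ≡⟨ cong₂ (λ a b → red (a ℚ.+ b)) (∉supp⇒≡0 i∉x) (∉supp⇒≡0 i∉y) ⟩
  0ℚ                               ∎) (∈supp⁻ i∈)
  where open ≡-Reasoning

_∈⋃supp_ : ∀ {e n} → Fin e → Vec (Pt e) n → Set
i ∈⋃supp ys = Any (λ y → i ∈ˢ supp y) ys

∈⋃suppV⁻ : ∀ {e n} {ys : Vec (Pt e) n} {i} → i ∈ˢ ⋃suppV ys → i ∈⋃supp ys
∈⋃suppV⁻ {ys = []}     i∈ = contradiction i∈ ∉⊥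
∈⋃suppV⁻ {ys = y ∷ ys} i∈ = [ here , there ∘ ∈⋃suppV⁻ {ys = ys} ]′ (x∈p∪q⁻ (supp y) (⋃suppV ys) i∈)

∈⋃suppV⁺ : ∀ {e n} {ys : Vec (Pt e) n} {i} → i ∈⋃supp ys → i ∈ˢ ⋃suppV ys
∈⋃suppV⁺ (here i∈y)   = x∈p∪q⁺ (inj₁ i∈y)
∈⋃suppV⁺ (there i∈ys) = x∈p∪q⁺ (inj₂ (∈⋃suppV⁺ i∈ys))

∈⋃suppL⁻ : ∀ {e} {xs : List (Pt e)} {i} → i ∈ˢ ⋃suppL xs → ∃ λ z → z ∈ xs × i ∈ˢ supp z
∈⋃suppL⁻ {xs = []}     i∈ = contradiction i∈ ∉⊥
∈⋃suppL⁻ {xs = x ∷ xs} i∈ with x∈p∪q⁻ (supp x) (⋃suppL xs) i∈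
... | inj₁ i∈x  = x , here refl , i∈x
... | inj₂ i∈xs = let z , z∈ , i∈z = ∈⋃suppL⁻ {xs = xs} i∈xs in z , there z∈ , i∈z

supp⊆⋃suppL : ∀ {e} {xs : List (Pt e)} {z} → z ∈ xs → supp z ⊆ˢ ⋃suppL xs
supp⊆⋃suppL (here refl) i∈ = x∈p∪q⁺ (inj₁ i∈)
supp⊆⋃suppL (there z∈) i∈ = x∈p∪q⁺ (inj₂ (supp⊆⋃suppL z∈ i∈))

⋃suppV⊆⋃suppL : ∀ {e q} {Λ : List (Pt e)} {xs : Vec (Pt e) q} → All (_∈ Λ) xs → ⋃suppV xs ⊆ˢ ⋃suppL Λ
⋃suppV⊆⋃suppL []          i∈ = contradiction i∈ ∉⊥
⋃suppV⊆⋃suppL (x∈ ∷ xs∈) i∈ = [ supp⊆⋃suppL x∈ , ⋃suppV⊆⋃suppL xs∈ ]′ (x∈p∪q⁻ _ _ i∈)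

wtOn : ∀ {e} → Subset e → Pt e → ℕ
wtOn C z = ∣ C ∩ supp z ∣

wtOn-⊤ : ∀ {e} (z : Pt e) → wtOn ⊤ z ≡ wt z
wtOn-⊤ z = cong ∣_∣ (∩-identityˡ (supp z))

wtOn-halving : ∀ {e} (C : Subset e) {u z : Pt e} → Reduced u → Reduced z →
               wtOn C (u ⊕ z) ≤ wtOn C u → wtOn C z ≤ wtOn C u → wtOn (C ─ supp u) z ≤ ⌊ wtOn C u /2⌋
wtOn-halving C {u} {z} ru rz ⊕-bound z-bound = begin
  ∣ (C ─ supp u) ∩ supp z ∣          ≤⟨ p⊆q⇒∣p∣≤∣q∣ restrict ⟩
  ∣ (C ∩ supp z) ─ (C ∩ supp u) ∣    ≤⟨ ∣t─s∣≤⌊∣s∣/2⌋ _ _ (C ∩ supp (u ⊕ z)) (─⊆⊕ ru) z─u⊆ ⊕-bound z-bound ⟩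
  ⌊ wtOn C u /2⌋                     ∎
  where
  open ≤-Reasoning
  ─⊆⊕ : ∀ {x y} → Reduced x → (C ∩ supp x) ─ (C ∩ supp y) ⊆ˢ C ∩ supp (x ⊕ y)
  ─⊆⊕ {x} {y} rx i∈ =
    let i∈C , i∈x = x∈p∩q⁻ C (supp x) (p─q⊆p _ _ i∈) in
    x∈p∩q⁺ (i∈C , ∈supp-⊕ˡ rx i∈x λ i∈y → x∈p─q⇒x∉q i∈ (x∈p∩q⁺ (i∈C , i∈y)))
  z─u⊆ : (C ∩ supp z) ─ (C ∩ supp u) ⊆ˢ C ∩ supp (u ⊕ z)
  z─u⊆ = subst (λ y → (C ∩ supp z) ─ (C ∩ supp u) ⊆ˢ C ∩ supp y) (⊕-comm z u) (─⊆⊕ rz)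
  restrict : (C ─ supp u) ∩ supp z ⊆ˢ (C ∩ supp z) ─ (C ∩ supp u)
  restrict i∈ =
    let i∈C─u , i∈z = x∈p∩q⁻ (C ─ supp u) (supp z) i∈ in
    x∈p∧x∉q⇒x∈p─q (x∈p∩q⁺ (p─q⊆p C (supp u) i∈C─u , i∈z))
                   (λ i∈C∩u → x∈p─q⇒x∉q i∈C─u (p∩q⊆q C (supp u) i∈C∩u))

-- Multiples and linear combinations

infix 21 _·_

_·_ : ∀ {e} → ℕ → Pt e → Pt e
zero  · y = 𝟘
suc n · y = y ⊕ n · y

·-reduced : ∀ {e} n (y : Pt e) → Reduced (n · y)
·-reduced zero    y = 𝟘-reduced
·-reduced (suc n) y = ⊕-reduced y (n · y)

·-distribʳ-+ : ∀ {e} a b (y : Pt e) → (a + b) · y ≡ a · y ⊕ b · y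
·-distribʳ-+ zero    b y = sym (⊕-identityˡ (·-reduced b y))
·-distribʳ-+ (suc a) b y = trans (cong (y ⊕_) (·-distribʳ-+ a b y)) (sym (⊕-assoc y (a · y) (b · y)))

·-distribˡ-⊕ : ∀ {e} n (u v : Pt e) → n · (u ⊕ v) ≡ n · u ⊕ n · v
·-distribˡ-⊕ zero    u v = sym (⊕-identityˡ 𝟘-reduced)
·-distribˡ-⊕ (suc n) u v =
  trans (cong ((u ⊕ v) ⊕_) (·-distribˡ-⊕ n u v)) (⊕-interchange u v (n · u) (n · v))

supp-·⊆ : ∀ {e} n (u : Pt e) → supp (n · u) ⊆ˢ supp u
supp-·⊆ zero    u i∈ = contradiction i∈ (∉supp-𝟘 _)
supp-·⊆ (suc n) u i∈ = [ id , supp-·⊆ n u ]′ (x∈p∪q⁻ _ _ (supp-⊕⊆∪ u (n · u) i∈))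

linComb : ∀ {e q} → Vec ℕ q → Vec (Pt e) q → Pt e
linComb []       []       = 𝟘
linComb (c ∷ cs) (y ∷ ys) = c · y ⊕ linComb cs ys

linComb-reduced : ∀ {e q} (cs : Vec ℕ q) (ys : Vec (Pt e) q) → Reduced (linComb cs ys)
linComb-reduced []       []       = 𝟘-reduced
linComb-reduced (c ∷ cs) (y ∷ ys) = ⊕-reduced (c · y) (linComb cs ys)

linComb-zeros : ∀ {e q} (ys : Vec (Pt e) q) → linComb (replicate q 0) ys ≡ 𝟘
linComb-zeros []       = refl
linComb-zeros (y ∷ ys) = trans (cong (𝟘 ⊕_) (linComb-zeros ys)) (⊕-identityˡ 𝟘-reduced)

linComb-+ : ∀ {e q} (cs ds : Vec ℕ q) (ys : Vec (Pt e) q) →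
            linComb (zipWith _+_ cs ds) ys ≡ linComb cs ys ⊕ linComb ds ys
linComb-+ []       []       []       = sym (⊕-identityˡ 𝟘-reduced)
linComb-+ (c ∷ cs) (d ∷ ds) (y ∷ ys) =
  trans (cong₂ _⊕_ (·-distribʳ-+ c d y) (linComb-+ cs ds ys))
        (⊕-interchange (c · y) (d · y) (linComb cs ys) (linComb ds ys))

Closed : ∀ {e} → (Pt e → Set) → Set
Closed P = ∀ {a b} → P a → P b → P (a ⊕ b)

reduced-closed : ∀ {e} → Closed (Reduced {e})
reduced-closed {a = a} {b} _ _ = ⊕-reduced a b

linComb-closed : ∀ {e q} {P : Pt e → Set} → Closed P → P 𝟘 →
                 {ys : Vec (Pt e) q} → All P ys → ∀ cs → P (linComb cs ys)
linComb-closed cl p𝟘 []         []       = p𝟘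
linComb-closed {P = P} cl p𝟘 {y ∷ _} (py ∷ pys) (c ∷ cs) = cl (multiple c) (linComb-closed cl p𝟘 pys cs)
  where
  multiple : ∀ n → P (n · y)
  multiple zero    = p𝟘
  multiple (suc n) = cl py (multiple n)

Span : ∀ {e q} → Vec (Pt e) q → Pt e → Set
Span ys z = ∃ λ cs → linComb cs ys ≡ z

span-closed : ∀ {e q} {ys : Vec (Pt e) q} → Closed (Span ys)
span-closed {ys = ys} (cs , refl) (ds , refl) = zipWith _+_ cs ds , linComb-+ cs ds ys

span-𝟘 : ∀ {e q} {ys : Vec (Pt e) q} → Span ys 𝟘
span-𝟘 {ys = ys} = replicate _ 0 , linComb-zeros ys

span-generators : ∀ {e q} {ys : Vec (Pt e) q} → All Reduced ys → All (Span ys) ys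
span-generators {ys = []}     []         = []
span-generators {ys = y ∷ ys} (ry ∷ rys) = (1 ∷ replicate _ 0 , y∈) ∷ All.map weaken (span-generators rys)
  where
  y∈ : (y ⊕ 𝟘) ⊕ linComb (replicate _ 0) ys ≡ y
  y∈ = trans (cong ((y ⊕ 𝟘) ⊕_) (linComb-zeros ys)) (trans (⊕-identityʳ (⊕-reduced y 𝟘)) (⊕-identityʳ ry))
  weaken : ∀ {z} → Span ys z → Span (y ∷ ys) z
  weaken (cs , refl) = 0 ∷ cs , ⊕-identityˡ (linComb-reduced cs ys)

-- Euclid's algorithm on coefficients

record Euclid {e n} (x : Pt e) (ys : Vec (Pt e) (suc n)) : Set₁ where
  field
    d      : ℕ
    u      : Pt e
    vs     : Vec (Pt e) n
    x≡d·u  : x ≡ d · u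
    closed : ∀ {P : Pt e → Set} → Closed P → All P ys → All P (u ∷ vs)
    covers : ∀ {i} → i ∈⋃supp ys → i ∈⋃supp (u ∷ vs)

module _ {e : ℕ} where

  euclid-trivial : ∀ c {n} {y : Pt e} {ys : Vec (Pt e) n} → Euclid (c · y) (y ∷ ys)
  euclid-trivial c {y = y} {ys} = record
    { d = c ; u = y ; vs = ys ; x≡d·u = refl ; closed = λ _ → id ; covers = id }

  euclid-swap : ∀ {x y z : Pt e} → Euclid x (y ∷ z ∷ []) → Euclid x (z ∷ y ∷ [])
  euclid-swap E = record
    { E hiding (closed; covers)
    ; closed = λ { cl (pz ∷ py ∷ []) → E.closed cl (py ∷ pz ∷ []) }
    ; covers = λ { (here i∈z) → E.covers (there (here i∈z)) ; (there (here i∈y)) → E.covers (here i∈y) }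
    }
    where module E = Euclid E

  euclid-shift : ∀ {x y z : Pt e} → Reduced y → Euclid x ((y ⊕ z) ∷ z ∷ []) → Euclid x (y ∷ z ∷ [])
  euclid-shift {z = z} ry E = record { E hiding (closed; covers) ; closed = closed ; covers = covers }
    where
    module E = Euclid E
    closed : ∀ {P} → Closed P → All P _ → All P _
    closed cl (py ∷ pz ∷ []) = E.closed cl (cl py pz ∷ pz ∷ [])
    covers : ∀ {i} → i ∈⋃supp _ → i ∈⋃supp _
    covers {i} (here i∈y) with i ∈? supp z
    ... | yes i∈z = E.covers (there (here i∈z))
    ... | no  i∉z = E.covers (here (∈supp-⊕ˡ ry i∈y i∉z))
    covers (there i∈z) = E.covers (there i∈z)

  euclid-step : ∀ c k {y z : Pt e} → Reduced y →
                Euclid (c · (y ⊕ z) ⊕ k · z) ((y ⊕ z) ∷ z ∷ []) → Euclid (c · y ⊕ (c + k) · z) (y ∷ z ∷ [])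
  euclid-step c k {y} {z} ry E = subst (λ x → Euclid x _) (sym regroup) (euclid-shift ry E)
    where
    open ≡-Reasoning
    regroup : c · y ⊕ (c + k) · z ≡ c · (y ⊕ z) ⊕ k · z
    regroup = begin
      c · y ⊕ (c + k) · z        ≡⟨ cong (c · y ⊕_) (·-distribʳ-+ c k z) ⟩
      c · y ⊕ (c · z ⊕ k · z)    ≡⟨ sym (⊕-assoc (c · y) (c · z) (k · z)) ⟩
      (c · y ⊕ c · z) ⊕ k · z    ≡⟨ cong (_⊕ k · z) (sym (·-distribˡ-⊕ c y z)) ⟩
      c · (y ⊕ z) ⊕ k · z        ∎

  euclid-pair : ∀ c d {y z : Pt e} → Reduced y → Reduced z → Acc _<_ (c + d) →
                Euclid (c · y ⊕ d · z) (y ∷ z ∷ [])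
  euclid-pair c zero {y} ry rz _ =
    subst (λ x → Euclid x _) (sym (⊕-identityʳ (·-reduced c y))) (euclid-trivial c)
  euclid-pair zero d {z = z} ry rz _ =
    subst (λ x → Euclid x _) (sym (⊕-identityˡ (·-reduced d z))) (euclid-swap (euclid-trivial d))
  euclid-pair (suc c) (suc d) {y} {z} ry rz (acc rs) with ≤-total (suc c) (suc d)
  ... | inj₁ c≤d with m≤n⇒∃[o]m+o≡n c≤d
  ...   | k , refl = euclid-step (suc c) k ry
                       (euclid-pair (suc c) k (⊕-reduced y z) rz (rs (+-monoʳ-< (suc c) (m<n+m k (s≤s z≤n)))))
  euclid-pair (suc c) (suc d) {y} {z} ry rz (acc rs) | inj₂ d≤c with m≤n⇒∃[o]m+o≡n d≤c
  ...   | k , refl = subst (λ x → Euclid x _) (⊕-comm _ _)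
                       (euclid-swap (euclid-step (suc d) k rz
                         (euclid-pair (suc d) k (⊕-reduced z y) ry (rs (m<m+n (suc (d + k)) (s≤s z≤n))))))

euclid : ∀ {e n} (cs : Vec ℕ (suc n)) {ys : Vec (Pt e) (suc n)} → All Reduced ys → Euclid (linComb cs ys) ys
euclid (c ∷ []) {y ∷ []} _ =
  subst (λ x → Euclid x _) (sym (⊕-identityʳ (·-reduced c y))) (euclid-trivial c)
euclid (c ∷ cs@(_ ∷ _)) {y ∷ ys} (ry ∷ rys) = record
  { d      = F.d
  ; u      = F.u
  ; vs     = F.vs ++ E.vs
  ; x≡d·u  = trans (cong (c · y ⊕_) E.x≡d·u) F.x≡d·u
  ; closed = closed
  ; covers = covers
  }
  where
  module E = Euclid (euclid cs rys)
  ru₀ : Reduced E.u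
  ru₀ = All.head (E.closed reduced-closed rys)
  module F = Euclid (euclid-pair c E.d ry ru₀ (<-wellFounded _))
  closed : ∀ {P} → Closed P → All P (y ∷ ys) → All P (F.u ∷ F.vs ++ E.vs)
  closed cl (py ∷ pys) with E.closed cl pys
  ... | pu₀ ∷ pvs₀ with F.closed cl (py ∷ pu₀ ∷ [])
  ...   | pu ∷ pvs = pu ∷ All.++⁺ pvs pvs₀
  fromF : ∀ {i} → i ∈⋃supp (F.u ∷ F.vs) → i ∈⋃supp (F.u ∷ F.vs ++ E.vs)
  fromF (here i∈u)    = here i∈u
  fromF (there i∈vs)  = there (Any.++⁺ˡ i∈vs)
  covers : ∀ {i} → i ∈⋃supp (y ∷ ys) → i ∈⋃supp (F.u ∷ F.vs ++ E.vs)
  covers (here i∈y) = fromF (F.covers (here i∈y))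
  covers (there i∈ys) with E.covers i∈ys
  ... | here i∈u₀    = fromF (F.covers (there (here i∈u₀)))
  ... | there i∈vs₀  = there (Any.++⁺ʳ F.vs i∈vs₀)

-- The sums m + ⌊m/2⌋ + ⌊m/4⌋ + ⋯

halvingSum : ℕ → ℕ → ℕ
halvingSum zero    m = 0
halvingSum (suc k) m = m + halvingSum k ⌊ m /2⌋

halfIter-suc : ∀ k m → halfIter (suc k) m ≡ halfIter k ⌊ m /2⌋
halfIter-suc zero    m = refl
halfIter-suc (suc k) m = cong ⌊_/2⌋ (halfIter-suc k m)

halvingSum-suc : ∀ k m → halvingSum (suc k) m ≡ halvingSum k m + halfIter k m
halvingSum-suc zero    m = +-comm m 0
halvingSum-suc (suc k) m = begin
  m + halvingSum (suc k) h                 ≡⟨ cong (m +_) (halvingSum-suc k h) ⟩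
  m + (halvingSum k h + halfIter k h)      ≡⟨ sym (+-assoc m _ _) ⟩
  m + halvingSum k h + halfIter k h        ≡⟨ cong (m + halvingSum k h +_) (sym (halfIter-suc k m)) ⟩
  m + halvingSum k h + halfIter (suc k) m  ∎
  where
  open ≡-Reasoning
  h : ℕ
  h = ⌊ m /2⌋

sum-halfIter≡halvingSum : ∀ k m → sum (List.map (λ n → halfIter n m) (upTo k)) ≡ halvingSum k m
sum-halfIter≡halvingSum zero    m = refl
sum-halfIter≡halvingSum (suc k) m = begin
  sum (List.map h (upTo (suc k)))              ≡⟨ cong (sum ∘ List.map h) (sym (upTo-∷ʳ k)) ⟩
  sum (List.map h (upTo k List.++ List.[ k ])) ≡⟨ cong sum (map-++ h (upTo k) List.[ k ]) ⟩
  sum (List.map h (upTo k) List.++ List.[ h k ]) ≡⟨ sum-++ (List.map h (upTo k)) List.[ h k ] ⟩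
  sum (List.map h (upTo k)) + (h k + 0)        ≡⟨ cong₂ _+_ (sum-halfIter≡halvingSum k m) (+-identityʳ (h k)) ⟩
  halvingSum k m + h k                         ≡⟨ sym (halvingSum-suc k m) ⟩
  halvingSum (suc k) m                         ∎
  where
  open ≡-Reasoning
  h : ℕ → ℕ
  h = λ n → halfIter n m

f≡halvingSum : ∀ M → f M ≡ halvingSum (⌊log₂ M ⌋ + 1) M
f≡halvingSum M =
  trans (sum-halfIter≡halvingSum (suc ⌊log₂ M ⌋) M) (cong (λ k → halvingSum k M) (+-comm 1 ⌊log₂ M ⌋))

halvingSum-≤-+ : ∀ j k m → halvingSum k m ≤ halvingSum (j + k) m
halvingSum-≤-+ zero    k m = ≤-refl
halvingSum-≤-+ (suc j) k m =
  ≤-trans (halvingSum-≤-+ j k m) (subst (halvingSum (j + k) m ≤_) (sym (halvingSum-suc (j + k) m)) (m≤m+n _ _))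

2*⌊n/2⌋≤n : ∀ n → 2 * ⌊ n /2⌋ ≤ n
2*⌊n/2⌋≤n n = begin
  ⌊ n /2⌋ + (⌊ n /2⌋ + 0)  ≡⟨ cong (⌊ n /2⌋ +_) (+-identityʳ _) ⟩
  ⌊ n /2⌋ + ⌊ n /2⌋        ≤⟨ +-monoʳ-≤ ⌊ n /2⌋ (⌊n/2⌋≤⌈n/2⌉ n) ⟩
  ⌊ n /2⌋ + ⌈ n /2⌉        ≡⟨ ⌊n/2⌋+⌈n/2⌉≡n n ⟩
  n                        ∎
  where open ≤-Reasoning

-- 2m minus the left-hand side is the sum of the binary digits of m below position k.
halvingSum-bound : ∀ k m → halvingSum k m + 2 * halfIter k m ≤ 2 * m
halvingSum-bound zero    m = ≤-refl
halvingSum-bound (suc k) m = begin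
  m + halvingSum k h + 2 * halfIter (suc k) m   ≡⟨ cong (λ x → m + halvingSum k h + 2 * x) (halfIter-suc k m) ⟩
  m + halvingSum k h + 2 * halfIter k h         ≡⟨ +-assoc m _ _ ⟩
  m + (halvingSum k h + 2 * halfIter k h)       ≤⟨ +-monoʳ-≤ m (halvingSum-bound k h) ⟩
  m + 2 * h                                     ≤⟨ +-monoʳ-≤ m (≤-trans (2*⌊n/2⌋≤n m) (m≤m+n m 0)) ⟩
  2 * m                                         ∎
  where
  open ≤-Reasoning
  h : ℕ
  h = ⌊ m /2⌋

halvingSum-bound-tight : ∀ k m → halvingSum k m + 2 * halfIter k m ≡ 2 * m → m ≡ 2 ^ k * halfIter k m
halvingSum-bound-tight zero    m _  = sym (*-identityˡ m)
halvingSum-bound-tight (suc k) m eq = begin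
  m                                  ≡⟨ sym 2h≡m ⟩
  2 * h                              ≡⟨ cong (2 *_) (halvingSum-bound-tight k h rest≡2h) ⟩
  2 * (2 ^ k * halfIter k h)         ≡⟨ sym (*-assoc 2 (2 ^ k) (halfIter k h)) ⟩
  2 ^ suc k * halfIter k h           ≡⟨ cong (2 ^ suc k *_) (sym (halfIter-suc k m)) ⟩
  2 ^ suc k * halfIter (suc k) m     ∎
  where
  open ≡-Reasoning
  h : ℕ
  h = ⌊ m /2⌋
  rest : ℕ
  rest = halvingSum k h + 2 * halfIter k h
  rest≡m : rest ≡ m
  rest≡m = +-cancelˡ-≡ m rest m (begin
    m + rest                                     ≡⟨ sym (+-assoc m _ _) ⟩
    m + halvingSum k h + 2 * halfIter k h        ≡⟨ cong (λ x → m + halvingSum k h + 2 * x)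
                                                         (sym (halfIter-suc k m)) ⟩
    m + halvingSum k h + 2 * halfIter (suc k) m  ≡⟨ eq ⟩
    m + (m + 0)                                  ≡⟨ cong (m +_) (+-identityʳ m) ⟩
    m + m                                        ∎)
  2h≡m : 2 * h ≡ m
  2h≡m = ≤-antisym (2*⌊n/2⌋≤n m) (subst (_≤ 2 * h) rest≡m (halvingSum-bound k h))
  rest≡2h : rest ≡ 2 * h
  rest≡2h = trans rest≡m (sym 2h≡m)

⌊log₂2+n⌋≡1+⌊log₂1+⌊n/2⌋⌋ : ∀ n → ⌊log₂ suc (suc n) ⌋ ≡ suc ⌊log₂ suc ⌊ n /2⌋ ⌋
⌊log₂2+n⌋≡1+⌊log₂1+⌊n/2⌋⌋ n = cong suc (⌊log2⌋-acc-irrelevant (suc ⌊ n /2⌋))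

halfIter-⌊log₂⌋ : ∀ M → 1 ≤ M → halfIter ⌊log₂ M ⌋ M ≡ 1
halfIter-⌊log₂⌋ = <-rec (λ M → 1 ≤ M → halfIter ⌊log₂ M ⌋ M ≡ 1) step
  where
  step : ∀ M → (∀ {m} → m < M → 1 ≤ m → halfIter ⌊log₂ m ⌋ m ≡ 1) → 1 ≤ M → halfIter ⌊log₂ M ⌋ M ≡ 1
  step (suc zero)    _   _ = refl
  step (suc (suc n)) rec _ = begin
    halfIter ⌊log₂ suc (suc n) ⌋ (suc (suc n))  ≡⟨ cong (λ l → halfIter l (suc (suc n)))
                                                       (⌊log₂2+n⌋≡1+⌊log₂1+⌊n/2⌋⌋ n) ⟩
    halfIter (suc ℓ) (suc (suc n))              ≡⟨ halfIter-suc ℓ (suc (suc n)) ⟩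
    halfIter ℓ (suc ⌊ n /2⌋)                    ≡⟨ rec (⌊n/2⌋<n (suc n)) (s≤s z≤n) ⟩
    1                                           ∎
    where
    open ≡-Reasoning
    ℓ : ℕ
    ℓ = ⌊log₂ suc ⌊ n /2⌋ ⌋

halfIter-⌊log₂⌋+1 : ∀ M → 1 ≤ M → halfIter (⌊log₂ M ⌋ + 1) M ≡ 0
halfIter-⌊log₂⌋+1 M 1≤M =
  trans (cong (λ k → halfIter k M) (+-comm ⌊log₂ M ⌋ 1)) (cong ⌊_/2⌋ (halfIter-⌊log₂⌋ M 1≤M))

f≡halvingSum+1 : ∀ M → 1 ≤ M → f M ≡ halvingSum ⌊log₂ M ⌋ M + 1
f≡halvingSum+1 M 1≤M = begin
  f M                                             ≡⟨ sum-halfIter≡halvingSum (suc ⌊log₂ M ⌋) M ⟩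
  halvingSum (suc ⌊log₂ M ⌋) M                    ≡⟨ halvingSum-suc ⌊log₂ M ⌋ M ⟩
  halvingSum ⌊log₂ M ⌋ M + halfIter ⌊log₂ M ⌋ M   ≡⟨ cong (halvingSum ⌊log₂ M ⌋ M +_) (halfIter-⌊log₂⌋ M 1≤M) ⟩
  halvingSum ⌊log₂ M ⌋ M + 1                      ∎
  where open ≡-Reasoning

f+1≡halvingSum+2*halfIter : ∀ M → 1 ≤ M → f M + 1 ≡ halvingSum ⌊log₂ M ⌋ M + 2 * halfIter ⌊log₂ M ⌋ M
f+1≡halvingSum+2*halfIter M 1≤M = begin
  f M + 1                       ≡⟨ cong (_+ 1) (f≡halvingSum+1 M 1≤M) ⟩
  halvingSum ℓ M + 1 + 1        ≡⟨ +-assoc (halvingSum ℓ M) 1 1 ⟩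
  halvingSum ℓ M + 2 * 1        ≡⟨ cong (λ x → halvingSum ℓ M + 2 * x) (sym (halfIter-⌊log₂⌋ M 1≤M)) ⟩
  halvingSum ℓ M + 2 * halfIter ℓ M  ∎
  where
  open ≡-Reasoning
  ℓ : ℕ
  ℓ = ⌊log₂ M ⌋

f+1≤2M : ∀ M → 1 ≤ M → f M + 1 ≤ 2 * M
f+1≤2M M 1≤M = subst (_≤ 2 * M) (sym (f+1≡halvingSum+2*halfIter M 1≤M)) (halvingSum-bound ⌊log₂ M ⌋ M)

2M∸1≤f⇒M≡2^r : ∀ M → 2 ≤ M → 2 * M ∸ 1 ≤ f M → Σ ℕ (λ r → (r ≥ 1) × (M ≡ 2 ^ r))
2M∸1≤f⇒M≡2^r M M≥2 2M∸1≤f with ⌊log₂ M ⌋ | M≡2^ℓ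
  where
  1≤M : 1 ≤ M
  1≤M = ≤-trans (s≤s z≤n) M≥2
  ℓ : ℕ
  ℓ = ⌊log₂ M ⌋
  2M≤f+1 : 2 * M ≤ f M + 1
  2M≤f+1 = subst (_≤ f M + 1) (m∸n+n≡m (≤-trans 1≤M (m≤m+n M _))) (+-monoˡ-≤ 1 2M∸1≤f)
  tight : halvingSum ℓ M + 2 * halfIter ℓ M ≡ 2 * M
  tight = trans (sym (f+1≡halvingSum+2*halfIter M 1≤M)) (≤-antisym (f+1≤2M M 1≤M) 2M≤f+1)
  M≡2^ℓ : M ≡ 2 ^ ℓ
  M≡2^ℓ = trans (halvingSum-bound-tight ℓ M tight)
                (trans (cong (2 ^ ℓ *_) (halfIter-⌊log₂⌋ M 1≤M)) (*-identityʳ (2 ^ ℓ)))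
... | zero  | M≡1   = contradiction (subst (2 ≤_) M≡1 M≥2) λ { (s≤s ()) }
... | suc r | M≡2^r = suc r , s≤s z≤n , M≡2^r

f≤halvingSum⇒⌊log₂⌋<q : ∀ M q → 1 ≤ M → f M ≤ halvingSum q M → ⌊log₂ M ⌋ + 1 ≤ q
f≤halvingSum⇒⌊log₂⌋<q M q 1≤M f≤ = ≮⇒≥ λ q<ℓ+1 → <⇒≱ (begin-strict
  halvingSum q M              ≤⟨ subst (λ l → halvingSum q M ≤ halvingSum l M) (m∸n+n≡m (q≤ℓ q<ℓ+1))
                                   (halvingSum-≤-+ (⌊log₂ M ⌋ ∸ q) q M) ⟩
  halvingSum ⌊log₂ M ⌋ M      <⟨ m<m+n _ (s≤s z≤n) ⟩
  halvingSum ⌊log₂ M ⌋ M + 1  ≡⟨ sym (f≡halvingSum+1 M 1≤M) ⟩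
  f M                         ∎) f≤
  where
  open ≤-Reasoning
  q≤ℓ : q < ⌊log₂ M ⌋ + 1 → q ≤ ⌊log₂ M ⌋
  q≤ℓ q<ℓ+1 = m<1+n⇒m≤n (subst (q <_) (+-comm ⌊log₂ M ⌋ 1) q<ℓ+1)

-- Covering bounds

¬¬-max : ∀ {A : Set} (w : A → ℕ) m → A → (∀ a → w a ≤ m) → ¬ ¬ (∃ λ a → ∀ b → w b ≤ w a)
¬¬-max w m a₀ bounded ¬max = atLeast (suc m) λ (a , m<wa) → <⇒≱ m<wa (bounded a)
  where
  notMax : ∀ a → ¬ ¬ (∃ λ b → w a < w b)
  notMax a ¬bigger = ¬max (a , λ b → ≮⇒≥ λ wa<wb → ¬bigger (b , wa<wb))
  atLeast : ∀ k → ¬ ¬ (∃ λ a → k ≤ w a)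
  atLeast zero    ¬reached = ¬reached (a₀ , z≤n)
  atLeast (suc k) ¬reached =
    atLeast k λ (a , k≤wa) → notMax a λ (b , wa<wb) → ¬reached (b , ≤-trans (s≤s k≤wa) wa<wb)

span-bound : ∀ {e} q (C : Subset e) m {ys : Vec (Pt e) q} → All Reduced ys →
             (∀ cs → wtOn C (linComb cs ys) ≤ m) → ∣ C ∩ ⋃suppV ys ∣ ≤ halvingSum q m
span-bound {e} zero C m {[]} _ _ = ≤-reflexive (trans (cong ∣_∣ (∩-zeroʳ C)) (∣⊥∣≡0 e))
span-bound {e} (suc q) C m {ys} rys bounded =
  -- A coefficient vector of maximal weight exists only classically, but the goal is decidable.
  decidable-stable (_ ≤? _) (¬¬-map fromMax (¬¬-max w m (replicate _ 0) bounded))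
  where
  w : Vec ℕ (suc q) → ℕ
  w = λ cs → wtOn C (linComb cs ys)
  fromMax : (∃ λ cs → ∀ ds → w ds ≤ w cs) → ∣ C ∩ ⋃suppV ys ∣ ≤ halvingSum (suc q) m
  fromMax (cs , maximal) = begin
    ∣ C ∩ ⋃suppV ys ∣
      ≤⟨ p⊆q⇒∣p∣≤∣q∣ (∩-monoʳ-⊆ C (∈⋃suppV⁺ ∘ E.covers ∘ ∈⋃suppV⁻)) ⟩
    ∣ C ∩ (supp E.u ∪ ⋃suppV E.vs) ∣
      ≤⟨ p⊆q⇒∣p∣≤∣q∣ (∩-∪-split C (supp E.u) (⋃suppV E.vs)) ⟩
    ∣ (C ∩ supp E.u) ∪ (C ─ supp E.u) ∩ ⋃suppV E.vs ∣
      ≤⟨ ∣p∪q∣≤∣p∣+∣q∣ (C ∩ supp E.u) _ ⟩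
    wtOn C E.u + ∣ (C ─ supp E.u) ∩ ⋃suppV E.vs ∣
      ≤⟨ +-mono-≤ W≤m rest ⟩
    m + halvingSum q ⌊ m /2⌋
      ∎
    where
    open ≤-Reasoning
    module E = Euclid (euclid cs rys)
    u∈ : Span ys E.u
    u∈ = All.head (E.closed span-closed (span-generators rys))
    vs∈ : All (Span ys) E.vs
    vs∈ = All.tail (E.closed span-closed (span-generators rys))
    ru : Reduced E.u
    ru = All.head (E.closed reduced-closed rys)
    rvs : All Reduced E.vs
    rvs = All.tail (E.closed reduced-closed rys)
    span≤W : ∀ {z} → Span ys z → wtOn C z ≤ wtOn C E.u
    span≤W (ds , refl) = ≤-trans (maximal ds)
      (p⊆q⇒∣p∣≤∣q∣ (∩-monoʳ-⊆ C (supp-·⊆ E.d E.u ∘ subst (λ x → _ ∈ˢ supp x) E.x≡d·u)))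
    W≤m : wtOn C E.u ≤ m
    W≤m = let cu , cu≡u = u∈ in subst (λ x → wtOn C x ≤ m) cu≡u (bounded cu)
    rest : ∣ (C ─ supp E.u) ∩ ⋃suppV E.vs ∣ ≤ halvingSum q ⌊ m /2⌋
    rest = span-bound q (C ─ supp E.u) ⌊ m /2⌋ rvs λ ds →
      let z∈ = linComb-closed span-closed span-𝟘 vs∈ ds in
      ≤-trans (wtOn-halving C ru (linComb-reduced ds E.vs) (span≤W (span-closed u∈ z∈)) (span≤W z∈))
              (⌊n/2⌋-mono W≤m)

module _ {e : ℕ} {Λ : List (Pt e)} (G : IsFiniteSubgroup Λ) where
  open IsFiniteSubgroup G

  greedy-cover : ∀ k (C : Subset e) m → halfIter k m ≡ 0 → (∀ {z} → z ∈ Λ → wtOn C z ≤ m) →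
                 ∃ λ (xs : Vec (Pt e) k) → All (_∈ Λ) xs × (C ∩ suppΛ Λ ⊆ˢ ⋃suppV xs)
  greedy-cover zero C m m≡0 bounded = [] , [] , λ i∈ →
    let i∈C , i∈Λ = x∈p∩q⁻ C (suppΛ Λ) i∈
        z , z∈ , i∈z = ∈⋃suppL⁻ {xs = Λ} i∈Λ
    in contradiction (≤-trans (x∈p⇒∣p-x∣<∣p∣ (x∈p∩q⁺ (i∈C , i∈z))) (subst (wtOn C z ≤_) m≡0 (bounded z∈))) n≮0
  greedy-cover (suc k) C m m≡0 bounded =
    let xs , xs∈Λ , xs-covers =
          greedy-cover k (C ─ supp x) ⌊ m /2⌋ (trans (sym (halfIter-suc k m)) m≡0) rest-bound
    in x ∷ xs , x∈Λ ∷ xs∈Λ , ─∩⊆⇒∩⊆∪ C (supp x) (suppΛ Λ) xs-covers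
    where
    x : Pt e
    x = argmax (wtOn C) 𝟘 Λ
    x∈Λ : x ∈ Λ
    x∈Λ = argmax-all (wtOn C) has-zero (LAll.tabulate id)
    maximal : ∀ {z} → z ∈ Λ → wtOn C z ≤ wtOn C x
    maximal = LAll.lookup (f[xs]≤f[argmax] 𝟘 Λ)
    rest-bound : ∀ {z} → z ∈ Λ → wtOn (C ─ supp x) z ≤ ⌊ m /2⌋
    rest-bound z∈ = ≤-trans
      (wtOn-halving C (LAll.lookup reduced x∈Λ) (LAll.lookup reduced z∈) (maximal (closed-+ x∈Λ z∈)) (maximal z∈))
      (⌊n/2⌋-mono (bounded x∈Λ))

  ⋃suppV-bound : ∀ {M} → WtLe Λ M → ∀ {q} {xs : Vec (Pt e) q} → All (_∈ Λ) xs → ∣ ⋃suppV xs ∣ ≤ halvingSum q M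
  ⋃suppV-bound {M} wt≤M {q} {xs} xs∈Λ = subst (_≤ halvingSum q M) (cong ∣_∣ (∩-identityˡ (⋃suppV xs)))
    (span-bound q ⊤ M (All.map (LAll.lookup reduced) xs∈Λ) λ cs →
      subst (_≤ M) (sym (wtOn-⊤ (linComb cs xs))) (wt≤M (linComb-closed closed-+ has-zero xs∈Λ cs)))

  small-cover : ∀ {M} → WtLe Λ M → 1 ≤ M →
                Σ (Vec (Pt e) (⌊log₂ M ⌋ + 1)) (λ xs → All (_∈ Λ) xs × (⋃suppV xs ≡ suppΛ Λ))
  small-cover {M} wt≤M 1≤M =
    let xs , xs∈Λ , covers = greedy-cover (⌊log₂ M ⌋ + 1) ⊤ M (halfIter-⌊log₂⌋+1 M 1≤M)
                               λ {z} z∈ → subst (_≤ M) (sym (wtOn-⊤ z)) (wt≤M z∈)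
    in xs , xs∈Λ , ⊆-antisym (⋃suppV⊆⋃suppL xs∈Λ) (λ i∈ → covers (x∈p∩q⁺ (∈⊤ , i∈)))

proposition2p3 : (e M : ℕ) → e ≥ 3 → M ≥ 2 →
    (Λ : List (Pt e)) → IsFiniteSubgroup Λ →
    WtLe Λ M → ∣ suppΛ Λ ∣ ≡ e →
      ((e ≤ f M) × (f M ≤ 2 * M ∸ 1))
      × ((e ≡ 2 * M ∸ 1) → Σ ℕ (λ r → (r ≥ 1) × (M ≡ 2 ^ r)))
      × ((e ≡ f M) →
          (Σ (Vec (Pt e) (⌊log₂ M ⌋ + 1)) (λ xs → All (_∈ Λ) xs × (⋃suppV xs ≡ suppΛ Λ)))
          × ((q : ℕ) → (xs : Vec (Pt e) q) → All (_∈ Λ) xs → ⋃suppV xs ≡ suppΛ Λ →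
               q ≥ ⌊log₂ M ⌋ + 1))
proposition2p3 e M _ M≥2 Λ G wt≤M ∣suppΛ∣≡e =
    (e≤f , m+n≤o⇒m≤o∸n (f M) (f+1≤2M M 1≤M))
  , (λ e≡2M∸1 → 2M∸1≤f⇒M≡2^r M M≥2 (subst (_≤ f M) e≡2M∸1 e≤f))
  , (λ e≡f → cover , λ q xs xs∈Λ ⋃xs≡suppΛ →
       f≤halvingSum⇒⌊log₂⌋<q M q 1≤M (subst (_≤ halvingSum q M) e≡f (e≤halvingSum xs∈Λ ⋃xs≡suppΛ)))
  where
  1≤M : 1 ≤ M
  1≤M = ≤-trans (s≤s z≤n) M≥2
  e≤halvingSum : ∀ {q} {xs : Vec (Pt e) q} → All (_∈ Λ) xs → ⋃suppV xs ≡ suppΛ Λ → e ≤ halvingSum q M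
  e≤halvingSum xs∈Λ ⋃xs≡suppΛ =
    subst (_≤ _) (trans (cong ∣_∣ ⋃xs≡suppΛ) ∣suppΛ∣≡e) (⋃suppV-bound G wt≤M xs∈Λ)
  cover : Σ (Vec (Pt e) (⌊log₂ M ⌋ + 1)) (λ xs → All (_∈ Λ) xs × (⋃suppV xs ≡ suppΛ Λ))
  cover = small-cover G wt≤M 1≤M
  e≤f : e ≤ f M
  e≤f = subst (e ≤_) (sym (f≡halvingSum M)) (e≤halvingSum (proj₁ (proj₂ cover)) (proj₂ (proj₂ cover)))
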